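{- For any complete chain $\mathbf{C}$, the pointed residuated lattice $\mathbf{Res}(\mathbf{C})$ is simple, i.e., its only congruences are the identity relation and the total relation.
   Context: Let $\mathbf{C}$ be a complete chain with least element $0$ and greatest element $\infty$. Let $\mathrm{res}(\mathbf{C})$ be the set of maps $C\to C$ preserving arbitrary joins. Then $\mathbf{Res}(\mathbf{C})=\langle \mathrm{res}(\mathbf{C}),\wedge,\vee,\circ,\backslash,/,\mathrm{id},d\rangle$, where $\wedge,\vee$ are pointwise, $\circ$ is composition, $\mathrm{id}$ is the identity map, $f\backslash h=\bigvee\{g\mid f\circ g\le h\}$, $h/g=\bigvee\{f\mid f\circ g\le h\}$, and $d(x)=\bigvee\{y\in C\mid y<x\}$. A congruence is an equivalence relation compatible with all these operations. -}

module Defs where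

open import Level using (Setω)
open import Data.Product using (Σ; ∃; _×_; _,_)
open import Data.Sum using (_⊎_)
open import Relation.Binary.PropositionalEquality using (_≡_; _≢_)
open import Relation.Binary.Structures using (IsTotalOrder)

record CompleteChain : Setω where
  field
    Carrier      : Set
    _≤_          : Carrier → Carrier → Set
    isTotalOrder : IsTotalOrder _≡_ _≤_
    ⋁            : ∀ {ℓ} → (Carrier → Set ℓ) → Carrier
    ⋁-upper      : ∀ {ℓ} (S : Carrier → Set ℓ) x → S x → x ≤ ⋁ S
    ⋁-least      : ∀ {ℓ} (S : Carrier → Set ℓ) u → (∀ x → S x → x ≤ u) → ⋁ S ≤ u

module ResOps (𝐂 : CompleteChain) where
  open CompleteChain 𝐂

  _<_ : Carrier → Carrier → Set
  x < y = x ≤ y × x ≢ y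

  IsRes : (Carrier → Carrier) → Set₁
  IsRes f = ∀ (S : Carrier → Set) → f (⋁ S) ≡ ⋁ (λ y → ∃ λ x → S x × y ≡ f x)

  _≤ᶠ_ : (Carrier → Carrier) → (Carrier → Carrier) → Set
  f ≤ᶠ g = ∀ x → f x ≤ g x

  _∧ᶠ_ : (Carrier → Carrier) → (Carrier → Carrier) → Carrier → Carrier
  (f ∧ᶠ g) x = ⋁ (λ y → y ≤ f x × y ≤ g x)

  _∨ᶠ_ : (Carrier → Carrier) → (Carrier → Carrier) → Carrier → Carrier
  (f ∨ᶠ g) x = ⋁ (λ y → y ≡ f x ⊎ y ≡ g x)

  _∘ᶠ_ : (Carrier → Carrier) → (Carrier → Carrier) → Carrier → Carrier
  (f ∘ᶠ g) x = f (g x)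

  idᶠ : Carrier → Carrier
  idᶠ x = x

  -- f \ h = ⋁ { g ∈ res(C) | f ∘ g ≤ h }  (join in res(C) is pointwise)
  _⧵ᶠ_ : (Carrier → Carrier) → (Carrier → Carrier) → Carrier → Carrier
  (f ⧵ᶠ h) x = ⋁ (λ y → Σ (Carrier → Carrier) λ g → IsRes g × ((f ∘ᶠ g) ≤ᶠ h) × y ≡ g x)

  _/ᶠ_ : (Carrier → Carrier) → (Carrier → Carrier) → Carrier → Carrier
  (h /ᶠ g) x = ⋁ (λ y → Σ (Carrier → Carrier) λ f → IsRes f × ((f ∘ᶠ g) ≤ᶠ h) × y ≡ f x)

  dᶠ : Carrier → Carrier
  dᶠ x = ⋁ (λ y → y < x)

  -- A binary relation on res(C) is represented by a
  -- relation θ on all maps C → C, of which only the restriction to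
  -- join-preserving maps matters.  Elements of res(C) are maps, so pointwise
  -- equal maps are identical: θ must contain pointwise equality (this also
  -- gives reflexivity).  The nullary operations id and d need no clause.
  record IsCongruence (θ : (Carrier → Carrier) → (Carrier → Carrier) → Set₁) : Set₁ where
    field
      θ-ext   : ∀ f g → IsRes f → IsRes g → (∀ x → f x ≡ g x) → θ f g
      θ-sym   : ∀ f g → IsRes f → IsRes g → θ f g → θ g f
      θ-trans : ∀ f g h → IsRes f → IsRes g → IsRes h → θ f g → θ g h → θ f h
      θ-∧ : ∀ f f' g g' → IsRes f → IsRes f' → IsRes g → IsRes g' →
            θ f f' → θ g g' → θ (f ∧ᶠ g) (f' ∧ᶠ g')
      θ-∨ : ∀ f f' g g' → IsRes f → IsRes f' → IsRes g → IsRes g' →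
            θ f f' → θ g g' → θ (f ∨ᶠ g) (f' ∨ᶠ g')
      θ-∘ : ∀ f f' g g' → IsRes f → IsRes f' → IsRes g → IsRes g' →
            θ f f' → θ g g' → θ (f ∘ᶠ g) (f' ∘ᶠ g')
      θ-⧵ : ∀ f f' g g' → IsRes f → IsRes f' → IsRes g → IsRes g' →
            θ f f' → θ g g' → θ (f ⧵ᶠ g) (f' ⧵ᶠ g')
      θ-/ : ∀ f f' g g' → IsRes f → IsRes f' → IsRes g → IsRes g' →
            θ f f' → θ g g' → θ (f /ᶠ g) (f' /ᶠ g')

  IsIdentityRel : ((Carrier → Carrier) → (Carrier → Carrier) → Set₁) → Set₁
  IsIdentityRel θ = ∀ f g → IsRes f → IsRes g → θ f g → ∀ x → f x ≡ g x

  IsTotalRel : ((Carrier → Carrier) → (Carrier → Carrier) → Set₁) → Set₁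
  IsTotalRel θ = ∀ f g → IsRes f → IsRes g → θ f g

  IsSimple : Set₂
  IsSimple = ∀ (θ : (Carrier → Carrier) → (Carrier → Carrier) → Set₁) →
             IsCongruence θ → IsIdentityRel θ ⊎ IsTotalRel θ

-- A congruence that identifies two maps f, g with f a < g a also identifies
-- cut ∘ f ∘ spread with cut ∘ g ∘ spread, where spread sends 0 to 0 and
-- everything else to a, and cut sends [0, f a] to 0 and everything else to ∞.
-- These composites are the least and the greatest element of res(C), and a
-- lattice congruence relating the bounds relates x = x ∨ ⊥ to x ∨ ⊤ = ⊤.

module Submission where

open import Defs
open import Axiom.ExcludedMiddle using (ExcludedMiddle)
open import Level using (0ℓ; suc)
open import Data.Product using (∃; _×_; _,_)
open import Data.Sum using (_⊎_; inj₁; inj₂)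
open import Data.Empty using (⊥; ⊥-elim)
open import Data.Unit using (⊤; tt)
open import Relation.Nullary using (Dec; yes; no; ¬_)
open import Relation.Binary.PropositionalEquality using (_≡_; refl; sym; trans; cong; subst)
open import Relation.Binary.Structures using (IsTotalOrder)

module CompleteChainProperties (𝐂 : CompleteChain) where
  open CompleteChain 𝐂
  open IsTotalOrder isTotalOrder public
    using (antisym; total; reflexive) renaming (trans to ≤-trans; refl to ≤-refl)

  ⊥c : Carrier
  ⊥c = ⋁ {0ℓ} (λ _ → ⊥)

  ⊤c : Carrier
  ⊤c = ⋁ {0ℓ} (λ _ → ⊤)

  ⊥c-least : ∀ x → ⊥c ≤ x
  ⊥c-least x = ⋁-least _ x (λ _ ())

  ⊤c-greatest : ∀ x → x ≤ ⊤c
  ⊤c-greatest x = ⋁-upper _ x tt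

  ⋁-cong : ∀ {a b} (P : Carrier → Set a) (Q : Carrier → Set b) →
           (∀ y → P y → Q y) → (∀ y → Q y → P y) → ⋁ P ≡ ⋁ Q
  ⋁-cong P Q P⇒Q Q⇒P = antisym
    (⋁-least P (⋁ Q) (λ y Py → ⋁-upper Q y (P⇒Q y Py)))
    (⋁-least Q (⋁ P) (λ y Qy → ⋁-upper P y (Q⇒P y Qy)))

  ⋁-pair-≤ : ∀ {s t} → s ≤ t → ⋁ (λ y → y ≡ s ⊎ y ≡ t) ≡ t
  ⋁-pair-≤ {s} {t} s≤t = antisym
    (⋁-least _ t (λ { _ (inj₁ refl) → s≤t ; _ (inj₂ refl) → ≤-refl }))
    (⋁-upper _ t (inj₂ refl))

  ⋁-pair-≥ : ∀ {s t} → t ≤ s → ⋁ (λ y → y ≡ s ⊎ y ≡ t) ≡ s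
  ⋁-pair-≥ {s} {t} t≤s = antisym
    (⋁-least _ s (λ { _ (inj₁ refl) → ≤-refl ; _ (inj₂ refl) → t≤s }))
    (⋁-upper _ s (inj₁ refl))

module ResProperties (𝐂 : CompleteChain) where
  open CompleteChain 𝐂
  open ResOps 𝐂
  open CompleteChainProperties 𝐂

  res-⊥c : ∀ {h} → IsRes h → h ⊥c ≡ ⊥c
  res-⊥c h-res = trans (h-res (λ _ → ⊥)) (⋁-cong _ _ (λ { _ (_ , () , _) }) (λ _ ()))

  res-≗ : ∀ {f h} → IsRes f → (∀ x → f x ≡ h x) → IsRes h
  res-≗ f-res f≗h S = trans (sym (f≗h _)) (trans (f-res S) (⋁-cong _ _
    (λ { _ (x , Sx , refl) → x , Sx , f≗h x })
    (λ { _ (x , Sx , refl) → x , Sx , sym (f≗h x) })))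

  res-∘ : ∀ {f g} → IsRes f → IsRes g → IsRes (f ∘ᶠ g)
  res-∘ {f} {g} f-res g-res S = trans (cong f (g-res S)) (trans (f-res _) (⋁-cong _ _
    (λ { _ (_ , (x , Sx , refl) , refl) → x , Sx , refl })
    (λ { _ (x , Sx , refl) → g x , (x , Sx , refl) , refl })))

  res-mono : ∀ {h x y} → IsRes h → x ≤ y → h x ≤ h y
  res-mono {h} {x} {y} h-res x≤y = subst (h x ≤_) h⋁≡hy
    (subst (h x ≤_) (sym (h-res pair)) (⋁-upper _ (h x) (x , inj₁ refl , refl)))
    where
      pair : Carrier → Set
      pair z = z ≡ x ⊎ z ≡ y
      h⋁≡hy : h (⋁ pair) ≡ h y
      h⋁≡hy = cong h (⋁-pair-≤ x≤y)

  res-≤ᶠ-∨ᶠ : ∀ {f h} → IsRes h → f ≤ᶠ h → IsRes (f ∨ᶠ h)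
  res-≤ᶠ-∨ᶠ h-res f≤h = res-≗ h-res (λ x → sym (⋁-pair-≤ (f≤h x)))

  ≤ᶠ-∨ᶠ-≗ : ∀ {f h} → f ≤ᶠ h → ∀ x → (f ∨ᶠ h) x ≡ h x
  ≤ᶠ-∨ᶠ-≗ f≤h x = ⋁-pair-≤ (f≤h x)

  ≥ᶠ-∨ᶠ-≗ : ∀ {f h} → h ≤ᶠ f → ∀ x → (f ∨ᶠ h) x ≡ f x
  ≥ᶠ-∨ᶠ-≗ h≤f x = ⋁-pair-≥ (h≤f x)

  res-≥ᶠ-∨ᶠ : ∀ {f h} → IsRes f → h ≤ᶠ f → IsRes (f ∨ᶠ h)
  res-≥ᶠ-∨ᶠ f-res h≤f = res-≗ f-res (λ x → sym (≥ᶠ-∨ᶠ-≗ h≤f x))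

  module _ {θ : (Carrier → Carrier) → (Carrier → Carrier) → Set₁} (θ-cong : IsCongruence θ) where
    open IsCongruence θ-cong

    θ-refl : ∀ h → IsRes h → θ h h
    θ-refl h h-res = θ-ext h h h-res h-res (λ _ → refl)

    total-if-bounds-related : ∀ {⊥ᶠ ⊤ᶠ} → IsRes ⊥ᶠ → IsRes ⊤ᶠ →
                              (∀ h → IsRes h → ⊥ᶠ ≤ᶠ h) → (∀ h → IsRes h → h ≤ᶠ ⊤ᶠ) →
                              θ ⊥ᶠ ⊤ᶠ → IsTotalRel θ
    total-if-bounds-related {⊥ᶠ} {⊤ᶠ} ⊥-res ⊤-res ⊥-least ⊤-greatest θ⊥⊤ f g f-res g-res =
      θ-trans f ⊤ᶠ g f-res ⊤-res g-res (θ-⊤ f f-res) (θ-sym g ⊤ᶠ g-res ⊤-res (θ-⊤ g g-res))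
      where
        θ-⊤ : ∀ h → IsRes h → θ h ⊤ᶠ
        θ-⊤ h h-res =
          θ-trans h (h ∨ᶠ ⊥ᶠ) ⊤ᶠ h-res h∨⊥-res ⊤-res
            (θ-ext h (h ∨ᶠ ⊥ᶠ) h-res h∨⊥-res (λ x → sym (≥ᶠ-∨ᶠ-≗ (⊥-least h h-res) x)))
            (θ-trans (h ∨ᶠ ⊥ᶠ) (h ∨ᶠ ⊤ᶠ) ⊤ᶠ h∨⊥-res h∨⊤-res ⊤-res
              (θ-∨ h h ⊥ᶠ ⊤ᶠ h-res h-res ⊥-res ⊤-res (θ-refl h h-res) θ⊥⊤)
              (θ-ext (h ∨ᶠ ⊤ᶠ) ⊤ᶠ h∨⊤-res ⊤-res (≤ᶠ-∨ᶠ-≗ (⊤-greatest h h-res))))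
          where
            h∨⊥-res : IsRes (h ∨ᶠ ⊥ᶠ)
            h∨⊥-res = res-≥ᶠ-∨ᶠ h-res (⊥-least h h-res)
            h∨⊤-res : IsRes (h ∨ᶠ ⊤ᶠ)
            h∨⊤-res = res-≤ᶠ-∨ᶠ ⊤-res (⊤-greatest h h-res)

module StepMaps (em : ∀ {ℓ} → ExcludedMiddle ℓ) (𝐂 : CompleteChain) where
  open CompleteChain 𝐂
  open ResOps 𝐂
  open CompleteChainProperties 𝐂

  step : Carrier → Carrier → Carrier → Carrier
  step c b x with em {0ℓ} {x ≤ c}
  ... | yes _ = ⊥c
  ... | no _  = b

  step-≤ : ∀ {c b x} → x ≤ c → step c b x ≡ ⊥c
  step-≤ {c} {b} {x} x≤c with em {0ℓ} {x ≤ c}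
  ... | yes _  = refl
  ... | no x≰c = ⊥-elim (x≰c x≤c)

  step-≰ : ∀ {c b x} → ¬ x ≤ c → step c b x ≡ b
  step-≰ {c} {b} {x} x≰c with em {0ℓ} {x ≤ c}
  ... | yes x≤c = ⊥-elim (x≰c x≤c)
  ... | no _    = refl

  step-≤-height : ∀ c b x → step c b x ≤ b
  step-≤-height c b x with em {0ℓ} {x ≤ c}
  ... | yes _ = ⊥c-least b
  ... | no _  = ≤-refl

  -- If ⋁ S ≰ c then, by excluded middle, some element of S is ≰ c and is sent to b.
  step-res : ∀ c b → IsRes (step c b)
  step-res c b S with em {0ℓ} {⋁ S ≤ c}
  ... | yes ⋁S≤c = antisym (⊥c-least _) (⋁-least _ ⊥c λ { _ (x , Sx , refl) →
          reflexive (step-≤ (≤-trans (⋁-upper S x Sx) ⋁S≤c)) })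
  ... | no ⋁S≰c with em {0ℓ} {∃ λ x → S x × ¬ x ≤ c}
  ...   | yes (x , Sx , x≰c) = antisym
            (⋁-upper _ b (x , Sx , sym (step-≰ x≰c)))
            (⋁-least _ b λ { _ (x' , _ , refl) → step-≤-height c b x' })
  ...   | no none-above = ⊥-elim (⋁S≰c (⋁-least S c λ x Sx → below x Sx))
    where
      below : ∀ x → S x → x ≤ c
      below x Sx with em {0ℓ} {x ≤ c}
      ... | yes x≤c = x≤c
      ... | no x≰c  = ⊥-elim (none-above (x , Sx , x≰c))

module SeparatedPair (em : ∀ {ℓ} → ExcludedMiddle ℓ) (𝐂 : CompleteChain) where
  open CompleteChain 𝐂
  open ResOps 𝐂
  open CompleteChainProperties 𝐂
  open ResProperties 𝐂
  open StepMaps em 𝐂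

  spread : Carrier → Carrier → Carrier
  spread a = step ⊥c a

  cut : (Carrier → Carrier) → Carrier → Carrier → Carrier
  cut f a = step (f a) ⊤c

  cut∘f∘spread-≡-⊥c : ∀ {f} → IsRes f → ∀ a x → (cut f a ∘ᶠ (f ∘ᶠ spread a)) x ≡ ⊥c
  cut∘f∘spread-≡-⊥c f-res a x = step-≤ (res-mono f-res (step-≤-height ⊥c a x))

  ≤ᶠ-cut∘g∘spread : ∀ {f g a} → ¬ g a ≤ f a →
                    ∀ h → IsRes h → h ≤ᶠ (cut f a ∘ᶠ (g ∘ᶠ spread a))
  ≤ᶠ-cut∘g∘spread {f} {g} {a} ga≰fa h h-res x = by-cases em
    where
      by-cases : Dec (x ≤ ⊥c) → h x ≤ (cut f a ∘ᶠ (g ∘ᶠ spread a)) x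
      by-cases (yes x≤⊥c) = subst (_≤ _) (sym hx≡⊥c) (⊥c-least _)
        where
          hx≡⊥c : h x ≡ ⊥c
          hx≡⊥c = trans (cong h (antisym x≤⊥c (⊥c-least x))) (res-⊥c h-res)
      by-cases (no x≰⊥c) =
        subst (h x ≤_) (sym (trans (cong (cut f a ∘ᶠ g) (step-≰ x≰⊥c)) (step-≰ ga≰fa)))
              (⊤c-greatest (h x))

  module _ {θ : (Carrier → Carrier) → (Carrier → Carrier) → Set₁} (θ-cong : IsCongruence θ) where
    open IsCongruence θ-cong

    total-if-separated : ∀ {f g} → IsRes f → IsRes g → θ f g →
                         ∀ {a} → ¬ g a ≤ f a → IsTotalRel θ
    total-if-separated {f} {g} f-res g-res θfg {a} ga≰fa =
      total-if-bounds-related θ-cong lower-res upper-res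
        (λ h _ x → subst (_≤ h x) (sym (cut∘f∘spread-≡-⊥c f-res a x)) (⊥c-least _))
        (≤ᶠ-cut∘g∘spread {f} {g} ga≰fa)
        (θ-∘ u u _ _ u-res u-res (res-∘ f-res v-res) (res-∘ g-res v-res) (θ-refl θ-cong u u-res)
          (θ-∘ f g v v f-res g-res v-res v-res θfg (θ-refl θ-cong v v-res)))
      where
        u v : Carrier → Carrier
        u = cut f a
        v = spread a
        u-res : IsRes u
        u-res = step-res _ _
        v-res : IsRes v
        v-res = step-res _ _
        lower-res : IsRes (u ∘ᶠ (f ∘ᶠ v))
        lower-res = res-∘ u-res (res-∘ f-res v-res)
        upper-res : IsRes (u ∘ᶠ (g ∘ᶠ v))
        upper-res = res-∘ u-res (res-∘ g-res v-res)

    identity-if-not-total : ¬ IsTotalRel θ → IsIdentityRel θ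
    identity-if-not-total ¬θ-total f g f-res g-res θfg x with em {0ℓ} {f x ≡ g x}
    ... | yes fx≡gx = fx≡gx
    ... | no fx≢gx with total (f x) (g x)
    ...   | inj₁ fx≤gx = ⊥-elim (¬θ-total (total-if-separated f-res g-res θfg
                            λ gx≤fx → fx≢gx (antisym fx≤gx gx≤fx)))
    ...   | inj₂ gx≤fx = ⊥-elim (¬θ-total (total-if-separated g-res f-res
                            (θ-sym f g f-res g-res θfg) λ fx≤gx → fx≢gx (antisym fx≤gx gx≤fx)))

proposition2p2 : (∀ {ℓ} → ExcludedMiddle ℓ) → (𝐂 : CompleteChain) → ResOps.IsSimple 𝐂
proposition2p2 em 𝐂 θ θ-cong with em {suc 0ℓ} {ResOps.IsTotalRel 𝐂 θ}
... | yes θ-total = inj₂ θ-total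
... | no ¬θ-total = inj₁ (SeparatedPair.identity-if-not-total em 𝐂 θ-cong ¬θ-total)
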